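{- Let $p>3$ be a prime, $q$ a power of $p$, $l\ge 0$ an integer, and $k=4$. Then $D_{p^l+2,k}(1,x)$ is a permutation polynomial of $\mathbb{F}_q$ if and only if the binomial $x^{\frac{p^l-1}{2}}-\frac12 x$ is a permutation polynomial of $\mathbb{F}_q$.
   Context: For an integer $k$ with $0\le k\le p-1$ and an integer $n\ge1$, $D_{n,k}(1,x)=\sum_{i=0}^{\lfloor n/2\rfloor}\frac{n-ki}{n-i}\binom{n-i}{i}(-x)^i\in\mathbb{F}_q[x]$ (the coefficients are integers, reduced mod $p$). A permutation polynomial of $\mathbb{F}_q$ is a polynomial inducing a bijection of $\mathbb{F}_q$. -}

module Defs where

open import Level using (0ℓ)
open import Data.Nat as ℕ using (ℕ; zero; suc; _∸_)
open import Data.Nat.Combinatorics using (_C_)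
open import Data.Fin using (Fin)
open import Data.Integer as ℤ using (ℤ; +_; -[1+_])
open import Data.Integer.DivMod using (_/ℕ_)
open import Relation.Binary.PropositionalEquality using (_≡_; _≢_)
open import Algebra.Structures using (IsCommutativeRing)
open import Function.Bundles using (_⤖_)
open import Function.Definitions using (Bijective)

record FiniteField : Set₁ where
  infixl 7 _*_
  infixl 6 _+_
  field
    Carrier : Set
    _+_ _*_ : Carrier → Carrier → Carrier
    -_ : Carrier → Carrier
    0# 1# : Carrier
    isCommutativeRing : IsCommutativeRing _≡_ _+_ _*_ -_ 0# 1#
    0≢1 : 0# ≢ 1#
    _⁻¹ : Carrier → Carrier
    inverseʳ : ∀ x → x ≢ 0# → x * (x ⁻¹) ≡ 1#
    size : ℕ
    enum : Fin size ⤖ Carrier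

module _ (F : FiniteField) where
  open FiniteField F

  _×1 : ℕ → Carrier
  zero ×1 = 0#
  suc n ×1 = 1# + (n ×1)

  fromℤ : ℤ → Carrier
  fromℤ (+ n) = n ×1
  fromℤ -[1+ n ] = - (suc n ×1)

  _^F_ : Carrier → ℕ → Carrier
  x ^F zero = 1#
  x ^F suc n = x * (x ^F n)

  sumUpTo : ℕ → (ℕ → Carrier) → Carrier
  sumUpTo zero f = f 0
  sumUpTo (suc m) f = sumUpTo m f + f (suc m)

  IsPermutation : (Carrier → Carrier) → Set
  IsPermutation f = Bijective _≡_ _≡_ f

-- The integer coefficient (n - k i)/(n - i) * binom(n - i, i), computed as the
-- exact integer quotient ((n - k i) * binom(n-i,i)) / (n - i).
-- (The divisor n ∸ i is nonzero for the indices 0 ≤ i ≤ ⌊n/2⌋, n ≥ 1, used below;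
-- the zero branch is never reached there.)
coeffD : ℕ → ℕ → ℕ → ℤ
coeffD n k i with n ∸ i
... | zero = + 0
... | suc m = ((+ n ℤ.- + (k ℕ.* i)) ℤ.* + ((n ∸ i) C i)) /ℕ suc m

Dnk : (F : FiniteField) → ℕ → ℕ → FiniteField.Carrier F → FiniteField.Carrier F
Dnk F n k x = sumUpTo F (n ℕ./ 2) (λ i → fromℤ F (coeffD n k i) * (_^F_ F (- x) i))
  where open FiniteField F

-- Write Q = p^l = 2q + 1 and w = 1 - 4x. The coefficients of D_{n,4}(1,x) are
-- C(n-i,i) - 3 C(n-i-1,i-1), and Pascal's rule turns this into the recurrence
-- D_{n+4} = D_{n+3} - x D_{n+2}. Hence b_k = 2^k D_{k+2}(1,x) satisfies
-- b_{k+2} = 2 b_{k+1} - 4x b_k, which is the recurrence of the powers of 1 + √w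
-- (a root of T² - 2T + 4x); comparing initial values, b_k = (1 + 2x) α_k + β_k where
-- (1 + √w)^k = α_k + β_k √w in F[√w]. In characteristic p the Frobenius gives
-- (1 + √w)^Q = 1 + w^q √w and 2^Q = 2, so 2 D_{Q+2}(1,x) = 1 + 2x + w^q. Thus
-- D_{Q+2}(1,·) is the binomial y ↦ y^q - y/2 pre- and post-composed with the affine
-- bijections x ↦ 1 - 4x and z ↦ (z + 3/2)/2.
module Submission where

open import Level using (0ℓ)
open import Function using (_∘_)
open import Function.Bundles using (_⇔_; mk⇔)
open import Function.Definitions using (Bijective; Injective; Surjective)
open import Function.Consequences.Propositional
  using (inverseᵇ⇒bijective; strictlyInverseˡ⇒inverseˡ; strictlyInverseʳ⇒inverseʳ)
import Function.Construct.Composition as Comp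
import Function.Properties.Equivalence as ⇔
open import Relation.Nullary using (contradiction)
open import Relation.Nullary.Decidable using (dec⇒maybe)
open import Relation.Binary.PropositionalEquality
import Data.Maybe as Maybe
open import Data.Sum using (inj₁; inj₂)
open import Data.Product as Prod using (∃; _,_; proj₁; proj₂)
open import Data.Fin as Fin using (Fin; fromℕ; inject₁)
open import Data.Fin.Properties using (toℕ-fromℕ; toℕ-inject₁; toℕ<n)
open import Data.Nat as ℕ using (ℕ; zero; suc; _∸_; _≤_; _<_; z≤n; s≤s)
import Data.Nat.Properties as ℕP
open import Data.Nat.DivMod
  using (_/_; _%_; m%n<n; m≡m%n+[m/n]*n; m*n%n≡0; m*n/n≡m; m/n*n≤m; /-monoˡ-≤; m/n≡1+[m∸n]/n)
open import Data.Nat.Divisibility using (_∣_; divides; ∣⇒≤)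
open import Data.Nat.Primality using (Prime; euclidsLemma; composite-≢; prime⇒¬composite)
open import Data.Nat.Combinatorics using (_C_; nCn≡1; nC1≡n; k>n⇒nCk≡0; nCk+nC[k+1]≡[n+1]C[k+1])
open import Data.Nat.Solver using () renaming (module +-*-Solver to ℕ-Solver)
open import Data.Integer as ℤ using (ℤ; +_; -[1+_]; _⊖_)
import Data.Integer.Properties as ℤP
open import Data.Integer.DivMod using (_/ℕ_)
open import Data.Integer.Solver using () renaming (module +-*-Solver to ℤ-Solver)
open import Algebra.Bundles using (CommutativeSemiring; CommutativeRing)
open import Algebra.Structures using (IsCommutativeSemiring)
open import Algebra.Structures.Biased using (isCommutativeSemiringˡ; isCommutativeMonoidˡ)
import Algebra.Solver.Ring.AlmostCommutativeRing as ACR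
import Algebra.Properties.Ring as RingProperties
import Algebra.Properties.AbelianGroup as AbelianGroupProperties
import Algebra.Properties.Semiring.Mult as SemiringMult
import Algebra.Properties.Semiring.Exp as SemiringExp
open import Defs

-- Binomial coefficients and natural-number arithmetic

[1+k]*[1+n]C[1+k]≡[1+n]*nCk : ∀ n k → suc k ℕ.* (suc n C suc k) ≡ suc n ℕ.* (n C k)
[1+k]*[1+n]C[1+k]≡[1+n]*nCk zero zero = refl
[1+k]*[1+n]C[1+k]≡[1+n]*nCk zero (suc k)
  rewrite k>n⇒nCk≡0 {1} {suc (suc k)} (s≤s (s≤s z≤n)) | k>n⇒nCk≡0 {0} {suc k} (s≤s z≤n) = ℕP.*-zeroʳ (suc (suc k))
[1+k]*[1+n]C[1+k]≡[1+n]*nCk (suc n) zero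
  rewrite nC1≡n (suc (suc n)) = trans (ℕP.+-identityʳ _) (sym (ℕP.*-identityʳ _))
[1+k]*[1+n]C[1+k]≡[1+n]*nCk (suc n) (suc k) = begin
  suc (suc k) ℕ.* (suc (suc n) C suc (suc k))
    ≡⟨ cong (suc (suc k) ℕ.*_) (nCk+nC[k+1]≡[n+1]C[k+1] (suc n) (suc k)) ⟨
  suc (suc k) ℕ.* (a ℕ.+ b)
    ≡⟨ solve 3 (λ k a b → (con 1 :+ k) :* (a :+ b) := (k :* a :+ a) :+ ((con 1 :+ k) :* b)) refl (suc k) a b ⟩
  (suc k ℕ.* a ℕ.+ a) ℕ.+ suc (suc k) ℕ.* b
    ≡⟨ cong₂ (λ u v → (u ℕ.+ a) ℕ.+ v) ([1+k]*[1+n]C[1+k]≡[1+n]*nCk n k) ([1+k]*[1+n]C[1+k]≡[1+n]*nCk n (suc k)) ⟩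
  (suc n ℕ.* (n C k) ℕ.+ a) ℕ.+ suc n ℕ.* (n C suc k)
    ≡⟨ solve 4 (λ m c d a → (m :* c :+ a) :+ m :* d := a :+ m :* (c :+ d)) refl (suc n) (n C k) (n C suc k) a ⟩
  a ℕ.+ suc n ℕ.* (n C k ℕ.+ n C suc k)
    ≡⟨ cong (λ c → a ℕ.+ suc n ℕ.* c) (nCk+nC[k+1]≡[n+1]C[k+1] n k) ⟩
  suc (suc n) ℕ.* a ∎
  where
  open ≡-Reasoning
  open ℕ-Solver
  a = suc n C suc k
  b = suc n C suc (suc k)

prime∣pCk : ∀ {p k} → Prime p → 0 < k → k < p → p ∣ p C k
prime∣pCk {suc n} {suc k} p-prime _ k<p
  with euclidsLemma (suc k) (suc n C suc k) p-prime
         (divides (n C k) (trans ([1+k]*[1+n]C[1+k]≡[1+n]*nCk n k) (ℕP.*-comm (suc n) (n C k))))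
... | inj₁ p∣k = contradiction (∣⇒≤ p∣k) (ℕP.<⇒≱ k<p)
... | inj₂ p∣C = p∣C

[1+m∸j]C[1+r]≡[m∸j]C[1+r]+[m∸j]Cr : ∀ m j r → j ≤ r → (suc m ∸ j) C suc r ≡ (m ∸ j) C suc r ℕ.+ (m ∸ j) C r
[1+m∸j]C[1+r]≡[m∸j]C[1+r]+[m∸j]Cr m zero r _ =
  trans (sym (nCk+nC[k+1]≡[n+1]C[k+1] m r)) (ℕP.+-comm (m C r) (m C suc r))
[1+m∸j]C[1+r]≡[m∸j]C[1+r]+[m∸j]Cr zero (suc j) (suc r) _
  rewrite ℕP.0∸n≡0 j | k>n⇒nCk≡0 {0} {suc (suc r)} (s≤s z≤n) | k>n⇒nCk≡0 {0} {suc r} (s≤s z≤n) = refl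
[1+m∸j]C[1+r]≡[m∸j]C[1+r]+[m∸j]Cr (suc m) (suc j) r j<r =
  [1+m∸j]C[1+r]≡[m∸j]C[1+r]+[m∸j]Cr m j r (ℕP.<⇒≤ j<r)

m<n⇒n∸m≡1+n∸[1+m] : ∀ {m n} → m < n → n ∸ m ≡ suc (n ∸ suc m)
m<n⇒n∸m≡1+n∸[1+m] {zero} {suc n} _ = refl
m<n⇒n∸m≡1+n∸[1+m] {suc m} {suc n} (s≤s m<n) = m<n⇒n∸m≡1+n∸[1+m] m<n

i+i≡i*2 : ∀ i → i ℕ.+ i ≡ i ℕ.* 2
i+i≡i*2 i = trans (cong (i ℕ.+_) (sym (ℕP.+-identityʳ i))) (ℕP.*-comm 2 i)

i≤n/2⇒i+i≤n : ∀ {i n} → i ≤ n / 2 → i ℕ.+ i ≤ n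
i≤n/2⇒i+i≤n {i} {n} i≤n/2 = begin
  i ℕ.+ i          ≡⟨ i+i≡i*2 i ⟩
  i ℕ.* 2          ≤⟨ ℕP.*-monoˡ-≤ 2 i≤n/2 ⟩
  n / 2 ℕ.* 2      ≤⟨ m/n*n≤m n 2 ⟩
  n ∎
  where open ℕP.≤-Reasoning

n/2<i⇒n<i+i : ∀ {i n} → n / 2 < i → n < i ℕ.+ i
n/2<i⇒n<i+i {i} {n} n/2<i = ℕP.≰⇒> λ i+i≤n → ℕP.<⇒≱ n/2<i (begin
  i                  ≡⟨ m*n/n≡m i 2 ⟨
  i ℕ.* 2 / 2        ≤⟨ /-monoˡ-≤ 2 (subst (_≤ n) (i+i≡i*2 i) i+i≤n) ⟩
  n / 2 ∎)
  where open ℕP.≤-Reasoning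

Odd : ℕ → Set
Odd n = ∃ λ k → n ≡ suc (k ℕ.+ k)

prime>2⇒odd : ∀ {p} → Prime p → 2 < p → Odd p
prime>2⇒odd {suc n} p-prime 2<p with suc n % 2 | m%n<n (suc n) 2 | m≡m%n+[m/n]*n (suc n) 2
... | 0 | _ | p≡[p/2]*2 =
  contradiction (composite-≢ 2 (ℕP.<⇒≢ 2<p) (divides (suc n / 2) p≡[p/2]*2)) (prime⇒¬composite p-prime)
... | 1 | _ | p≡1+[p/2]*2 = suc n / 2 , trans p≡1+[p/2]*2 (cong suc (sym (i+i≡i*2 (suc n / 2))))
... | suc (suc _) | s≤s (s≤s ()) | _

odd⇒odd^ : ∀ {n} → Odd n → ∀ l → Odd (n ℕ.^ l)
odd⇒odd^ _ zero = 0 , refl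
odd⇒odd^ {n} (k , refl) (suc l) with odd⇒odd^ (k , refl) l
... | q , n^l≡1+2q = q ℕ.+ k ℕ.* suc (q ℕ.+ q) , trans (cong (n ℕ.*_) n^l≡1+2q)
  (solve 2 (λ k q → (con 1 :+ (k :+ k)) :* (con 1 :+ (q :+ q))
                    := con 1 :+ ((q :+ k :* (con 1 :+ (q :+ q))) :+ (q :+ k :* (con 1 :+ (q :+ q))))) refl k q)
  where open ℕ-Solver

odd⇒≡1+2[[n∸1]/2] : ∀ {n} → Odd n → n ≡ suc ((n ∸ 1) / 2 ℕ.+ (n ∸ 1) / 2)
odd⇒≡1+2[[n∸1]/2] (k , refl) =
  cong (λ m → suc (m ℕ.+ m)) (sym (trans (cong (_/ 2) (i+i≡i*2 k)) (m*n/n≡m k 2)))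

-- Second-order recurrences and bijections

recurrence₂-unique : ∀ {a} {A : Set a} (step : A → A → A) {s t : ℕ → A} →
  (∀ k → s (2 ℕ.+ k) ≡ step (s (1 ℕ.+ k)) (s k)) → (∀ k → t (2 ℕ.+ k) ≡ step (t (1 ℕ.+ k)) (t k)) →
  s 0 ≡ t 0 → s 1 ≡ t 1 → ∀ k → s k ≡ t k
recurrence₂-unique step {s} {t} s-rec t-rec s0≡t0 s1≡t1 k = proj₁ (agree k)
  where
  agree : ∀ k → s k ≡ t k Prod.× s (suc k) ≡ t (suc k)
  agree zero = s0≡t0 , s1≡t1
  agree (suc k) with agree k
  ... | sk≡tk , s[1+k]≡t[1+k] =
    s[1+k]≡t[1+k] , trans (s-rec k) (trans (cong₂ step s[1+k]≡t[1+k] sk≡tk) (sym (t-rec k)))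

bijective-resp-≗ : ∀ {a} {A : Set a} {f g : A → A} → f ≗ g → Bijective _≡_ _≡_ f → Bijective _≡_ _≡_ g
bijective-resp-≗ {f = f} {g} f≗g (f-inj , f-surj) = g-inj , g-surj
  where
  g-inj : Injective _≡_ _≡_ g
  g-inj {x} {y} gx≡gy = f-inj (trans (f≗g x) (trans gx≡gy (sym (f≗g y))))
  g-surj : Surjective _≡_ _≡_ g
  g-surj y with f-surj y
  ... | x , fx≡y = x , λ { refl → trans (sym (f≗g x)) (fx≡y refl) }

module _ {a} {A : Set a} {φ ψ : A → A} (φ-bij : Bijective {A = A} _≡_ _≡_ φ) (ψ-bij : Bijective {A = A} _≡_ _≡_ ψ) where

  bijective⇔bijective-conjugate : (f : A → A) → Bijective _≡_ _≡_ f ⇔ Bijective _≡_ _≡_ (φ ∘ f ∘ ψ)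
  bijective⇔bijective-conjugate f = mk⇔ conjugate deconjugate
    where
    conjugate : Bijective _≡_ _≡_ f → Bijective _≡_ _≡_ (φ ∘ f ∘ ψ)
    conjugate f-bij = Comp.bijective _≡_ _≡_ _≡_ (Comp.bijective _≡_ _≡_ _≡_ ψ-bij f-bij) φ-bij

    deconjugate : Bijective _≡_ _≡_ (φ ∘ f ∘ ψ) → Bijective _≡_ _≡_ f
    deconjugate (g-inj , g-surj) = f-inj , f-surj
      where
      f-inj : Injective _≡_ _≡_ f
      f-inj {x} {y} fx≡fy with proj₂ ψ-bij x | proj₂ ψ-bij y
      ... | x′ , ψx′≡x | y′ , ψy′≡y with refl ← ψx′≡x refl | refl ← ψy′≡y refl =
        cong ψ (g-inj (cong φ fx≡fy))
      f-surj : Surjective _≡_ _≡_ f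
      f-surj y with g-surj (φ y)
      ... | x , gx≡φy = ψ x , λ { refl → proj₁ φ-bij (gx≡φy refl) }

-- The Frobenius endomorphism

module Frobenius {a ℓ} (S : CommutativeSemiring a ℓ) where
  open CommutativeSemiring S hiding (refl; sym; trans; setoid; zero)
  module S = CommutativeSemiring S
  open import Algebra.Properties.Semiring.Mult semiring using (_×_; ×-congʳ; ×-assoc-*; ×1-homo-*; ×-homo-1)
  open import Algebra.Properties.Semiring.Exp semiring using (_^_; ^-congˡ; ^-congʳ; ^-assocʳ)
  open import Algebra.Properties.Monoid.Sum +-monoid using (sum-init-last; sum-cong-≋; sum-replicate-zero)
  open import Algebra.Definitions.RawMonoid +-rawMonoid using (sum)
  open import Algebra.Properties.CommutativeSemiring.Binomial S using (theorem; binomialTerm)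
  open import Relation.Binary.Reasoning.Setoid S.setoid

  p∣c⇒c×z≈0# : ∀ {p c} → p × 1# ≈ 0# → p ∣ c → ∀ z → c × z ≈ 0#
  p∣c⇒c×z≈0# {p} char-p (divides q refl) z = begin
    (q ℕ.* p) × z                 ≈⟨ ×-congʳ (q ℕ.* p) (*-identityˡ z) ⟨
    (q ℕ.* p) × (1# * z)          ≈⟨ ×-assoc-* (q ℕ.* p) 1# z ⟨
    ((q ℕ.* p) × 1#) * z          ≈⟨ *-congʳ (×1-homo-* q p) ⟩
    ((q × 1#) * (p × 1#)) * z     ≈⟨ *-congʳ (S.trans (*-congˡ char-p) (zeroʳ _)) ⟩
    0# * z                        ≈⟨ zeroˡ z ⟩
    0# ∎

  1#^n≈1# : ∀ n → 1# ^ n ≈ 1#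
  1#^n≈1# zero = S.refl
  1#^n≈1# (suc n) = S.trans (*-identityˡ _) (1#^n≈1# n)

  ^-prime-+ : ∀ {p} → Prime p → p × 1# ≈ 0# → ∀ x y → (x + y) ^ p ≈ x ^ p + y ^ p
  ^-prime-+ {suc n} p-prime char-p x y = begin
    (x + y) ^ suc n                                                          ≈⟨ theorem (suc n) x y ⟩
    t Fin.zero + sum (t ∘ Fin.suc)                                           ≈⟨ +-cong first (sum-init-last (t ∘ Fin.suc)) ⟩
    y ^ suc n + (sum (λ k → t (Fin.suc (inject₁ k))) + t (Fin.suc (fromℕ n)))
      ≈⟨ +-congˡ (+-cong (S.trans (sum-cong-≋ middle) (sum-replicate-zero n)) last) ⟩
    y ^ suc n + (0# + x ^ suc n)                                             ≈⟨ S.trans (+-congˡ (+-identityˡ _)) (+-comm _ _) ⟩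
    x ^ suc n + y ^ suc n ∎
    where
    t : Fin (suc (suc n)) → Carrier
    t = binomialTerm x y (suc n)
    first : t Fin.zero ≈ y ^ suc n
    first = S.trans (×-homo-1 _) (*-identityˡ _)
    last : t (Fin.suc (fromℕ n)) ≈ x ^ suc n
    last rewrite toℕ-fromℕ n | nCn≡1 (suc n) | ℕP.n∸n≡0 n = S.trans (×-homo-1 _) (*-identityʳ _)
    middle : ∀ k → t (Fin.suc (inject₁ k)) ≈ 0#
    middle k = p∣c⇒c×z≈0# char-p (prime∣pCk p-prime (s≤s z≤n) (s≤s (subst (_< n) (sym (toℕ-inject₁ k)) (toℕ<n k)))) _

  ^-prime^-+ : ∀ {p} → Prime p → p × 1# ≈ 0# → ∀ l x y → (x + y) ^ (p ℕ.^ l) ≈ x ^ (p ℕ.^ l) + y ^ (p ℕ.^ l)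
  ^-prime^-+ p-prime char-p zero x y = S.trans (*-identityʳ _) (+-cong (S.sym (*-identityʳ _)) (S.sym (*-identityʳ _)))
  ^-prime^-+ {p} p-prime char-p (suc l) x y = begin
    (x + y) ^ (p ℕ.* q)              ≈⟨ ^-congʳ _ (ℕP.*-comm p q) ⟩
    (x + y) ^ (q ℕ.* p)              ≈⟨ ^-assocʳ _ q p ⟨
    ((x + y) ^ q) ^ p                ≈⟨ ^-congˡ p (^-prime^-+ p-prime char-p l x y) ⟩
    (x ^ q + y ^ q) ^ p              ≈⟨ ^-prime-+ p-prime char-p _ _ ⟩
    (x ^ q) ^ p + (y ^ q) ^ p        ≈⟨ +-cong (^-assocʳ _ q p) (^-assocʳ _ q p) ⟩
    x ^ (q ℕ.* p) + y ^ (q ℕ.* p)    ≈⟨ +-cong (^-congʳ _ (ℕP.*-comm q p)) (^-congʳ _ (ℕP.*-comm q p)) ⟩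
    x ^ (p ℕ.* q) + y ^ (p ℕ.* q) ∎
    where q = p ℕ.^ l

-- Integer coefficients of D_{n,4}(1,x)

[a*d]/ℕd≡a : ∀ a d .{{_ : ℕ.NonZero d}} → (a ℤ.* + d) /ℕ d ≡ a
[a*d]/ℕd≡a (+ n) (suc m) rewrite sym (ℤP.pos-* n (suc m)) = cong +_ (m*n/n≡m n (suc m))
[a*d]/ℕd≡a -[1+ n ] (suc m) with ℕ.suc (m ℕ.+ n ℕ.* suc m) ℕ.% suc m | m*n%n≡0 (suc n) (suc m)
... | .0 | refl = cong (λ k → ℤ.- + k) (m*n/n≡m (suc n) (suc m))

coeffD-unfold : ∀ n k i {m} → n ∸ i ≡ suc m → coeffD n k i ≡ ((+ n ℤ.- + (k ℕ.* i)) ℤ.* + (suc m C i)) /ℕ suc m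
coeffD-unfold n k i n∸i≡1+m with n ∸ i in eq
... | suc m rewrite eq with refl ← n∸i≡1+m = refl

-- (n - 4i)/(n - i) · C(n-i,i) with the division carried out, by the absorption identity.
coeff₄ : ℕ → ℕ → ℤ
coeff₄ n zero = + 1
coeff₄ n (suc j) = + ((n ∸ suc j) C suc j) ℤ.- + 3 ℤ.* + ((n ∸ suc (suc j)) C j)

coeffD≡coeff₄ : ∀ {n} i → 0 < n → i ℕ.+ i ≤ n → coeffD n 4 i ≡ coeff₄ n i
coeffD≡coeff₄ {suc m} zero _ _ = begin
  coeffD (suc m) 4 0                        ≡⟨ coeffD-unfold (suc m) 4 0 refl ⟩
  ((+ suc m ℤ.- + 0) ℤ.* + 1) /ℕ suc m      ≡⟨ cong (_/ℕ suc m)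
                                                 (solve 1 (λ N → (N :- con (+ 0)) :* con (+ 1) := con (+ 1) :* N) refl (+ suc m)) ⟩
  (+ 1 ℤ.* + suc m) /ℕ suc m                ≡⟨ [a*d]/ℕd≡a (+ 1) (suc m) ⟩
  + 1 ∎
  where
  open ≡-Reasoning
  open ℤ-Solver
coeffD≡coeff₄ {n} (suc j) _ 2j+2≤n = begin
  coeffD n 4 (suc j)                                ≡⟨ coeffD-unfold n 4 (suc j) n∸[1+j]≡1+M ⟩
  ((+ n ℤ.- + (4 ℕ.* suc j)) ℤ.* + c) /ℕ suc M      ≡⟨ cong (_/ℕ suc M) numerator ⟩
  ((+ c ℤ.- + 3 ℤ.* + c′) ℤ.* + suc M) /ℕ suc M     ≡⟨ [a*d]/ℕd≡a _ (suc M) ⟩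
  + c ℤ.- + 3 ℤ.* + c′                              ≡⟨ cong (λ m → + (m C suc j) ℤ.- + 3 ℤ.* + c′) n∸[1+j]≡1+M ⟨
  coeff₄ n (suc j) ∎
  where
  open ≡-Reasoning
  open ℤ-Solver
  M = n ∸ suc (suc j)
  c = suc M C suc j
  c′ = M C j
  n∸[1+j]≡1+M : n ∸ suc j ≡ suc M
  n∸[1+j]≡1+M = m<n⇒n∸m≡1+n∸[1+m] (ℕP.≤-trans (s≤s (ℕP.m≤n+m (suc j) j)) 2j+2≤n)
  n≡[1+M]+[1+j] : + n ≡ + suc M ℤ.+ + suc j
  n≡[1+M]+[1+j] = begin
    + n                        ≡⟨ cong +_ (ℕP.m∸n+n≡m (ℕP.≤-trans (ℕP.m≤n+m (suc j) (suc j)) 2j+2≤n)) ⟨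
    + (n ∸ suc j ℕ.+ suc j)    ≡⟨ cong (λ m → + (m ℕ.+ suc j)) n∸[1+j]≡1+M ⟩
    + (suc M ℕ.+ suc j)        ≡⟨ ℤP.pos-+ (suc M) (suc j) ⟩
    + suc M ℤ.+ + suc j ∎
  absorption : + suc j ℤ.* + c ≡ + suc M ℤ.* + c′
  absorption = trans (sym (ℤP.pos-* (suc j) c)) (trans (cong +_ ([1+k]*[1+n]C[1+k]≡[1+n]*nCk M j)) (ℤP.pos-* (suc M) c′))
  numerator : (+ n ℤ.- + (4 ℕ.* suc j)) ℤ.* + c ≡ (+ c ℤ.- + 3 ℤ.* + c′) ℤ.* + suc M
  numerator = begin
    (+ n ℤ.- + (4 ℕ.* suc j)) ℤ.* + c
      ≡⟨ cong₂ (λ a b → (a ℤ.- b) ℤ.* + c) n≡[1+M]+[1+j] (ℤP.pos-* 4 (suc j)) ⟩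
    ((+ suc M ℤ.+ + suc j) ℤ.- + 4 ℤ.* + suc j) ℤ.* + c
      ≡⟨ solve 3 (λ N I c → ((N :+ I) :- con (+ 4) :* I) :* c := N :* c :- con (+ 3) :* (I :* c)) refl (+ suc M) (+ suc j) (+ c) ⟩
    + suc M ℤ.* + c ℤ.- + 3 ℤ.* (+ suc j ℤ.* + c)
      ≡⟨ cong (λ e → + suc M ℤ.* + c ℤ.- + 3 ℤ.* e) absorption ⟩
    + suc M ℤ.* + c ℤ.- + 3 ℤ.* (+ suc M ℤ.* + c′)
      ≡⟨ solve 3 (λ N c c′ → N :* c :- con (+ 3) :* (N :* c′) := (c :- con (+ 3) :* c′) :* N) refl (+ suc M) (+ c) (+ c′) ⟩
    (+ c ℤ.- + 3 ℤ.* + c′) ℤ.* + suc M ∎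

coeff₄-recurrence : ∀ n i → coeff₄ (4 ℕ.+ n) (suc i) ≡ coeff₄ (3 ℕ.+ n) (suc i) ℤ.+ coeff₄ (2 ℕ.+ n) i
coeff₄-recurrence n zero = begin
  + ((3 ℕ.+ n) C 1) ℤ.- + 3 ℤ.* + 1
    ≡⟨ cong (λ m → + m ℤ.- + 3 ℤ.* + 1) ([1+m∸j]C[1+r]≡[m∸j]C[1+r]+[m∸j]Cr (2 ℕ.+ n) 0 0 z≤n) ⟩
  + ((2 ℕ.+ n) C 1 ℕ.+ 1) ℤ.- + 3 ℤ.* + 1
    ≡⟨ cong (λ m → m ℤ.- + 3 ℤ.* + 1) (ℤP.pos-+ ((2 ℕ.+ n) C 1) 1) ⟩
  (+ ((2 ℕ.+ n) C 1) ℤ.+ + 1) ℤ.- + 3 ℤ.* + 1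
    ≡⟨ solve 1 (λ a → (a :+ con (+ 1)) :- con (+ 3) :* con (+ 1) := (a :- con (+ 3) :* con (+ 1)) :+ con (+ 1))
               refl (+ ((2 ℕ.+ n) C 1)) ⟩
  (+ ((2 ℕ.+ n) C 1) ℤ.- + 3 ℤ.* + 1) ℤ.+ + 1 ∎
  where
  open ≡-Reasoning
  open ℤ-Solver
coeff₄-recurrence n (suc j) = begin
  + ((2 ℕ.+ n ∸ j) C suc (suc j)) ℤ.- + 3 ℤ.* + ((1 ℕ.+ n ∸ j) C suc j)
    ≡⟨ cong₂ (λ a b → + a ℤ.- + 3 ℤ.* + b) ([1+m∸j]C[1+r]≡[m∸j]C[1+r]+[m∸j]Cr (suc n) j (suc j) (ℕP.n≤1+n j))
                                             ([1+m∸j]C[1+r]≡[m∸j]C[1+r]+[m∸j]Cr n j j ℕP.≤-refl) ⟩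
  + (A ℕ.+ B) ℤ.- + 3 ℤ.* + (C′ ℕ.+ D)
    ≡⟨ cong₂ (λ a b → a ℤ.- + 3 ℤ.* b) (ℤP.pos-+ A B) (ℤP.pos-+ C′ D) ⟩
  (+ A ℤ.+ + B) ℤ.- + 3 ℤ.* (+ C′ ℤ.+ + D)
    ≡⟨ solve 4 (λ a b c d → (a :+ b) :- con (+ 3) :* (c :+ d) := (a :- con (+ 3) :* c) :+ (b :- con (+ 3) :* d))
               refl (+ A) (+ B) (+ C′) (+ D) ⟩
  (+ A ℤ.- + 3 ℤ.* + C′) ℤ.+ (+ B ℤ.- + 3 ℤ.* + D) ∎
  where
  open ≡-Reasoning
  open ℤ-Solver
  A = (1 ℕ.+ n ∸ j) C suc (suc j)
  B = (1 ℕ.+ n ∸ j) C suc j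
  C′ = (n ∸ j) C suc j
  D = (n ∸ j) C j

coeff₄-vanishes : ∀ {n} i → 2 ≤ n → n < i ℕ.+ i → coeff₄ n i ≡ + 0
coeff₄-vanishes zero 2≤n ()
coeff₄-vanishes (suc zero) 2≤n n<2 = contradiction n<2 (ℕP.≤⇒≯ 2≤n)
coeff₄-vanishes {n} (suc (suc j)) _ n<2i
  rewrite k>n⇒nCk≡0 (ℕP.m<n+o⇒m∸n<o n (suc (suc j)) n<2i)
        | k>n⇒nCk≡0 (ℕP.m<n+o⇒m∸n<o n (suc (suc (suc j))) (subst (n <_) (cong suc (ℕP.+-suc (suc j) (suc j))) n<2i))
  = refl

-- D_{n,4}(1,x) over F

module Dickson (F : FiniteField) where
  open FiniteField F using (_⁻¹; inverseʳ; 0≢1; isCommutativeRing)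

  commutativeRing : CommutativeRing 0ℓ 0ℓ
  commutativeRing = record { isCommutativeRing = isCommutativeRing }

  open CommutativeRing commutativeRing hiding (sym; trans; refl; reflexive; isEquivalence; setoid)
  open RingProperties ring using (-‿distribˡ-*; -‿distribʳ-*; -‿involutive; -0#≈0#)
  open AbelianGroupProperties +-abelianGroup using (⁻¹-∙-comm; xyx⁻¹≈y)
  open SemiringMult semiring using (_×_; ×-homo-+; ×1-homo-*)
  open SemiringExp semiring using () renaming (_^_ to _^ᶜ_)
  open ≡-Reasoning

  ι : ℕ → Carrier
  ι = _×1 F

  infixr 8 _^_
  _^_ : Carrier → ℕ → Carrier
  _^_ = _^F_ F

  ι≡×1 : ∀ n → ι n ≡ n × 1#
  ι≡×1 zero = refl
  ι≡×1 (suc n) = cong (_+_ 1#) (ι≡×1 n)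

  ι-+ : ∀ m n → ι (m ℕ.+ n) ≡ ι m + ι n
  ι-+ m n rewrite ι≡×1 (m ℕ.+ n) | ι≡×1 m | ι≡×1 n = ×-homo-+ 1# m n

  ι-* : ∀ m n → ι (m ℕ.* n) ≡ ι m * ι n
  ι-* m n rewrite ι≡×1 (m ℕ.* n) | ι≡×1 m | ι≡×1 n = ×1-homo-* m n

  ^≡^ᶜ : ∀ a n → a ^ n ≡ a ^ᶜ n
  ^≡^ᶜ a zero = refl
  ^≡^ᶜ a (suc n) = cong (a *_) (^≡^ᶜ a n)

  fromℤ-neg : ∀ z → fromℤ F (ℤ.- z) ≡ - fromℤ F z
  fromℤ-neg (+ zero) = sym -0#≈0#
  fromℤ-neg (+ suc n) = refl
  fromℤ-neg -[1+ n ] = sym (-‿involutive _)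

  fromℤ-⊖ : ∀ m n → fromℤ F (m ⊖ n) ≡ ι m - ι n
  fromℤ-⊖ m zero = begin
    fromℤ F (m ⊖ 0)      ≡⟨ cong (fromℤ F) (ℤP.⊖-≥ {m} {0} z≤n) ⟩
    ι m                  ≡⟨ +-identityʳ _ ⟨
    ι m + 0#             ≡⟨ cong (_+_ (ι m)) -0#≈0# ⟨
    ι m - 0# ∎
  fromℤ-⊖ zero (suc n) = begin
    fromℤ F (0 ⊖ suc n)  ≡⟨ cong (fromℤ F) (ℤP.⊖-< {0} {suc n} (s≤s z≤n)) ⟩
    - ι (suc n)          ≡⟨ +-identityˡ _ ⟨
    0# - ι (suc n) ∎
  fromℤ-⊖ (suc m) (suc n) = begin
    fromℤ F (suc m ⊖ suc n)      ≡⟨ cong (fromℤ F) (ℤP.[1+m]⊖[1+n]≡m⊖n m n) ⟩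
    fromℤ F (m ⊖ n)              ≡⟨ fromℤ-⊖ m n ⟩
    ι m - ι n                    ≡⟨ cong (_- ι n) (xyx⁻¹≈y 1# (ι m)) ⟨
    (1# + ι m - 1#) - ι n        ≡⟨ +-assoc _ _ _ ⟩
    (1# + ι m) + (- 1# - ι n)    ≡⟨ cong (_+_ (1# + ι m)) (⁻¹-∙-comm 1# (ι n)) ⟩
    (1# + ι m) - (1# + ι n) ∎

  fromℤ-+ : ∀ i j → fromℤ F (i ℤ.+ j) ≡ fromℤ F i + fromℤ F j
  fromℤ-+ (+ m) (+ n) = ι-+ m n
  fromℤ-+ (+ m) -[1+ n ] = fromℤ-⊖ m (suc n)
  fromℤ-+ -[1+ m ] (+ n) = trans (fromℤ-⊖ n (suc m)) (+-comm _ _)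
  fromℤ-+ -[1+ m ] -[1+ n ] = begin
    - ι (suc (suc (m ℕ.+ n)))    ≡⟨ cong (λ k → - ι (suc k)) (ℕP.+-suc m n) ⟨
    - ι (suc m ℕ.+ suc n)        ≡⟨ cong -_ (ι-+ (suc m) (suc n)) ⟩
    - (ι (suc m) + ι (suc n))    ≡⟨ ⁻¹-∙-comm _ _ ⟨
    - ι (suc m) - ι (suc n) ∎

  fromℤ-* : ∀ i j → fromℤ F (i ℤ.* j) ≡ fromℤ F i * fromℤ F j
  fromℤ-* (+ m) (+ n) = trans (cong (fromℤ F) (sym (ℤP.pos-* m n))) (ι-* m n)
  fromℤ-* (+ m) -[1+ n ] = begin
    fromℤ F (+ m ℤ.* -[1+ n ])         ≡⟨ cong (fromℤ F) (ℤP.neg-distribʳ-* (+ m) (+ suc n)) ⟨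
    fromℤ F (ℤ.- (+ m ℤ.* + suc n))    ≡⟨ fromℤ-neg (+ m ℤ.* + suc n) ⟩
    - fromℤ F (+ m ℤ.* + suc n)        ≡⟨ cong -_ (fromℤ-* (+ m) (+ suc n)) ⟩
    - (ι m * ι (suc n))                ≡⟨ -‿distribʳ-* _ _ ⟩
    ι m * - ι (suc n) ∎
  fromℤ-* -[1+ m ] (+ n) = begin
    fromℤ F (-[1+ m ] ℤ.* + n)         ≡⟨ cong (fromℤ F) (ℤP.neg-distribˡ-* (+ suc m) (+ n)) ⟨
    fromℤ F (ℤ.- (+ suc m ℤ.* + n))    ≡⟨ fromℤ-neg (+ suc m ℤ.* + n) ⟩
    - fromℤ F (+ suc m ℤ.* + n)        ≡⟨ cong -_ (fromℤ-* (+ suc m) (+ n)) ⟩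
    - (ι (suc m) * ι n)                ≡⟨ -‿distribˡ-* _ _ ⟩
    - ι (suc m) * ι n ∎
  fromℤ-* -[1+ m ] -[1+ n ] = begin
    ι (suc m ℕ.* suc n)                ≡⟨ ι-* (suc m) (suc n) ⟩
    ι (suc m) * ι (suc n)              ≡⟨ -‿involutive _ ⟨
    - - (ι (suc m) * ι (suc n))        ≡⟨ cong -_ (-‿distribˡ-* _ _) ⟩
    - (- ι (suc m) * ι (suc n))        ≡⟨ -‿distribʳ-* _ _ ⟩
    - ι (suc m) * - ι (suc n) ∎

  fromℤ-homomorphism : ACR._-Raw-AlmostCommutative⟶_ ℤ.+-*-rawRing (ACR.fromCommutativeRing commutativeRing)
  fromℤ-homomorphism = record
    { ⟦_⟧ = fromℤ F ; +-homo = fromℤ-+ ; *-homo = fromℤ-* ; -‿homo = fromℤ-neg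
    ; 0-homo = refl ; 1-homo = +-identityʳ 1# }

  open import Algebra.Solver.Ring ℤ.+-*-rawRing (ACR.fromCommutativeRing commutativeRing) fromℤ-homomorphism
    (λ i j → Maybe.map (cong (fromℤ F)) (dec⇒maybe (i ℤ.≟ j)))

  -- 1ᴾ evaluates to 1# itself, whereas con (+ 1) evaluates to 1# + 0#.
  1ᴾ 0ᴾ : ∀ {n} → Polynomial n
  1ᴾ = con (+ 0) :^ 0
  0ᴾ = con (+ 0)

  ι2≡1+1 : ι 2 ≡ 1# + 1#
  ι2≡1+1 = cong (_+_ 1#) (+-identityʳ 1#)

  1+1≢0 : ∀ {p} → Odd p → ι p ≡ 0# → 1# + 1# ≢ 0#
  1+1≢0 (k , refl) char-p 1+1≡0 = 0≢1 (begin
    0#                      ≡⟨ char-p ⟨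
    1# + ι (k ℕ.+ k)        ≡⟨ cong (_+_ 1#) (ι-+ k k) ⟩
    1# + (ι k + ι k)        ≡⟨ cong (_+_ 1#) (solve 1 (λ a → a :+ a := a :* (1ᴾ :+ 1ᴾ)) refl (ι k)) ⟩
    1# + ι k * (1# + 1#)    ≡⟨ cong (λ e → 1# + ι k * e) 1+1≡0 ⟩
    1# + ι k * 0#           ≡⟨ solve 1 (λ a → 1ᴾ :+ a :* 0ᴾ := 1ᴾ) refl (ι k) ⟩
    1# ∎)

  2*[1+1]⁻¹≡1 : ∀ {p} → Odd p → ι p ≡ 0# → ι 2 * (1# + 1#) ⁻¹ ≡ 1#
  2*[1+1]⁻¹≡1 p-odd char-p = trans (cong (_* (1# + 1#) ⁻¹) ι2≡1+1) (inverseʳ (1# + 1#) (1+1≢0 p-odd char-p))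

  ι2^[p^l]≡ι2 : ∀ {p} → Prime p → ι p ≡ 0# → ∀ l → ι 2 ^ (p ℕ.^ l) ≡ ι 2
  ι2^[p^l]≡ι2 {p} p-prime char-p l = begin
    ι 2 ^ Q                  ≡⟨ cong (_^ Q) ι2≡1+1 ⟩
    (1# + 1#) ^ Q            ≡⟨ ^≡^ᶜ (1# + 1#) Q ⟩
    (1# + 1#) ^ᶜ Q           ≡⟨ ^-prime^-+ p-prime (trans (sym (ι≡×1 p)) char-p) l 1# 1# ⟩
    1# ^ᶜ Q + 1# ^ᶜ Q        ≡⟨ cong₂ _+_ (1#^n≈1# Q) (1#^n≈1# Q) ⟩
    1# + 1#                  ≡⟨ ι2≡1+1 ⟨
    ι 2 ∎
    where
    open Frobenius commutativeSemiring using (^-prime^-+; 1#^n≈1#)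
    Q = p ℕ.^ l

  affine-bijective : ∀ {a a⁻¹} c → a⁻¹ * a ≡ 1# → Bijective _≡_ _≡_ (λ y → a * y + c)
  affine-bijective {a} {a⁻¹} c a⁻¹a≡1 = inverseᵇ⇒bijective
    (strictlyInverseˡ⇒inverseˡ f f∘f⁻¹≗id , strictlyInverseʳ⇒inverseʳ f f⁻¹∘f≗id)
    where
    f f⁻¹ : Carrier → Carrier
    f y = a * y + c
    f⁻¹ z = a⁻¹ * (z - c)
    f∘f⁻¹≗id : ∀ z → f (f⁻¹ z) ≡ z
    f∘f⁻¹≗id z = begin
      a * (a⁻¹ * (z - c)) + c   ≡⟨ solve 4 (λ a a′ z c → a :* (a′ :* (z :- c)) :+ c := (a′ :* a) :* (z :- c) :+ c)
                                           refl a a⁻¹ z c ⟩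
      (a⁻¹ * a) * (z - c) + c   ≡⟨ cong (λ e → e * (z - c) + c) a⁻¹a≡1 ⟩
      1# * (z - c) + c          ≡⟨ solve 2 (λ z c → 1ᴾ :* (z :- c) :+ c := z) refl z c ⟩
      z ∎
    f⁻¹∘f≗id : ∀ y → f⁻¹ (f y) ≡ y
    f⁻¹∘f≗id y = begin
      a⁻¹ * ((a * y + c) - c)   ≡⟨ solve 4 (λ a a′ y c → a′ :* ((a :* y :+ c) :- c) := (a′ :* a) :* y) refl a a⁻¹ y c ⟩
      (a⁻¹ * a) * y             ≡⟨ cong (_* y) a⁻¹a≡1 ⟩
      1# * y                    ≡⟨ *-identityˡ y ⟩
      y ∎

  sumUpTo-cong : ∀ m {f g} → (∀ i → i ≤ m → f i ≡ g i) → sumUpTo F m f ≡ sumUpTo F m g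
  sumUpTo-cong zero f≗g = f≗g 0 z≤n
  sumUpTo-cong (suc m) f≗g =
    cong₂ _+_ (sumUpTo-cong m (λ i i≤m → f≗g i (ℕP.m≤n⇒m≤1+n i≤m))) (f≗g (suc m) ℕP.≤-refl)

  sumUpTo-extend : ∀ {m n} f → m ≤ n → (∀ i → m < i → f i ≡ 0#) → sumUpTo F n f ≡ sumUpTo F m f
  sumUpTo-extend {m} {n} f m≤n f-vanishes = trans (cong (λ k → sumUpTo F k f) (sym (ℕP.m∸n+n≡m m≤n))) (extend (n ∸ m))
    where
    extend : ∀ d → sumUpTo F (d ℕ.+ m) f ≡ sumUpTo F m f
    extend zero = refl
    extend (suc d) = trans (cong₂ _+_ (extend d) (f-vanishes _ (s≤s (ℕP.m≤n+m m d)))) (+-identityʳ _)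

  sumUpTo-suc : ∀ m f → sumUpTo F (suc m) f ≡ f 0 + sumUpTo F m (f ∘ suc)
  sumUpTo-suc zero f = refl
  sumUpTo-suc (suc m) f = trans (cong (_+ f (suc (suc m))) (sumUpTo-suc m f)) (+-assoc _ _ _)

  sumUpTo-+ : ∀ m f g → sumUpTo F m (λ i → f i + g i) ≡ sumUpTo F m f + sumUpTo F m g
  sumUpTo-+ zero f g = refl
  sumUpTo-+ (suc m) f g = trans (cong (_+ (f (suc m) + g (suc m))) (sumUpTo-+ m f g))
    (solve 4 (λ a b c d → (a :+ b) :+ (c :+ d) := (a :+ c) :+ (b :+ d)) refl (sumUpTo F m f) (sumUpTo F m g) (f (suc m)) (g (suc m)))

  sumUpTo-*ˡ : ∀ m c f → sumUpTo F m (λ i → c * f i) ≡ c * sumUpTo F m f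
  sumUpTo-*ˡ zero c f = refl
  sumUpTo-*ˡ (suc m) c f = trans (cong (_+ (c * f (suc m))) (sumUpTo-*ˡ m c f)) (sym (distribˡ _ _ _))

  dicksonTerm : Carrier → ℕ → ℕ → Carrier
  dicksonTerm x n i = fromℤ F (coeff₄ n i) * (- x) ^ i

  Dnk≡sumUpTo-dicksonTerm : ∀ {n K} x → 2 ≤ n → n / 2 ≤ K → Dnk F n 4 x ≡ sumUpTo F K (dicksonTerm x n)
  Dnk≡sumUpTo-dicksonTerm {n} {K} x 2≤n n/2≤K = begin
    Dnk F n 4 x
      ≡⟨ sumUpTo-cong (n / 2) (λ i i≤n/2 → cong (λ c → fromℤ F c * (- x) ^ i)
           (coeffD≡coeff₄ i (ℕP.≤-trans (s≤s z≤n) 2≤n) (i≤n/2⇒i+i≤n i≤n/2))) ⟩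
    sumUpTo F (n / 2) (dicksonTerm x n)
      ≡⟨ sumUpTo-extend (dicksonTerm x n) n/2≤K (λ i n/2<i → trans
           (cong (λ c → fromℤ F c * (- x) ^ i) (coeff₄-vanishes i 2≤n (n/2<i⇒n<i+i n/2<i))) (zeroˡ _)) ⟨
    sumUpTo F K (dicksonTerm x n) ∎

  dicksonTerm-recurrence : ∀ x n i →
    dicksonTerm x (4 ℕ.+ n) (suc i) ≡ dicksonTerm x (3 ℕ.+ n) (suc i) + (- x) * dicksonTerm x (2 ℕ.+ n) i
  dicksonTerm-recurrence x n i = begin
    fromℤ F (coeff₄ (4 ℕ.+ n) (suc i)) * ((- x) * (- x) ^ i)
      ≡⟨ cong (λ c → fromℤ F c * ((- x) * (- x) ^ i)) (coeff₄-recurrence n i) ⟩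
    fromℤ F (coeff₄ (3 ℕ.+ n) (suc i) ℤ.+ coeff₄ (2 ℕ.+ n) i) * ((- x) * (- x) ^ i)
      ≡⟨ cong (_* ((- x) * (- x) ^ i)) (fromℤ-+ (coeff₄ (3 ℕ.+ n) (suc i)) (coeff₄ (2 ℕ.+ n) i)) ⟩
    (a + b) * ((- x) * (- x) ^ i)
      ≡⟨ solve 4 (λ a b y q → (a :+ b) :* (y :* q) := a :* (y :* q) :+ y :* (b :* q)) refl a b (- x) ((- x) ^ i) ⟩
    a * ((- x) * (- x) ^ i) + (- x) * (b * (- x) ^ i) ∎
    where
    a = fromℤ F (coeff₄ (3 ℕ.+ n) (suc i))
    b = fromℤ F (coeff₄ (2 ℕ.+ n) i)

  Dnk-recurrence : ∀ n x → Dnk F (4 ℕ.+ n) 4 x ≡ Dnk F (3 ℕ.+ n) 4 x + (- x) * Dnk F (2 ℕ.+ n) 4 x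
  Dnk-recurrence n x = begin
    Dnk F (4 ℕ.+ n) 4 x
      ≡⟨ Dnk≡sumUpTo-dicksonTerm x 2≤2+ (ℕP.≤-reflexive [4+n]/2≡1+K) ⟩
    sumUpTo F (suc K) T₄
      ≡⟨ sumUpTo-suc K T₄ ⟩
    T₃ 0 + sumUpTo F K (T₄ ∘ suc)
      ≡⟨ cong (_+_ (T₃ 0)) (sumUpTo-cong K (λ i _ → dicksonTerm-recurrence x n i)) ⟩
    T₃ 0 + sumUpTo F K (λ i → T₃ (suc i) + (- x) * T₂ i)
      ≡⟨ cong (_+_ (T₃ 0)) (sumUpTo-+ K (T₃ ∘ suc) (λ i → (- x) * T₂ i)) ⟩
    T₃ 0 + (sumUpTo F K (T₃ ∘ suc) + sumUpTo F K (λ i → (- x) * T₂ i))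
      ≡⟨ +-assoc _ _ _ ⟨
    (T₃ 0 + sumUpTo F K (T₃ ∘ suc)) + sumUpTo F K (λ i → (- x) * T₂ i)
      ≡⟨ cong₂ _+_ (sumUpTo-suc K T₃) (sym (sumUpTo-*ˡ K (- x) T₂)) ⟨
    sumUpTo F (suc K) T₃ + (- x) * sumUpTo F K T₂
      ≡⟨ cong₂ (λ s t → s + (- x) * t) (Dnk≡sumUpTo-dicksonTerm x 2≤2+ [3+n]/2≤1+K)
                                       (Dnk≡sumUpTo-dicksonTerm x 2≤2+ (ℕP.≤-reflexive [2+n]/2≡K)) ⟨
    Dnk F (3 ℕ.+ n) 4 x + (- x) * Dnk F (2 ℕ.+ n) 4 x ∎
    where
    T₄ T₃ T₂ : ℕ → Carrier
    T₄ = dicksonTerm x (4 ℕ.+ n)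
    T₃ = dicksonTerm x (3 ℕ.+ n)
    T₂ = dicksonTerm x (2 ℕ.+ n)
    K = suc (n / 2)
    2≤2+ : ∀ {m} → 2 ≤ 2 ℕ.+ m
    2≤2+ = s≤s (s≤s z≤n)
    [2+n]/2≡K : (2 ℕ.+ n) / 2 ≡ K
    [2+n]/2≡K = m/n≡1+[m∸n]/n {2 ℕ.+ n} {2} 2≤2+
    [4+n]/2≡1+K : (4 ℕ.+ n) / 2 ≡ suc K
    [4+n]/2≡1+K = trans (m/n≡1+[m∸n]/n {4 ℕ.+ n} {2} 2≤2+) (cong suc [2+n]/2≡K)
    [3+n]/2≤1+K : (3 ℕ.+ n) / 2 ≤ suc K
    [3+n]/2≤1+K = ℕP.≤-trans (/-monoˡ-≤ 2 (ℕP.n≤1+n (3 ℕ.+ n))) (ℕP.≤-reflexive [4+n]/2≡1+K)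

  Dnk-2 : ∀ x → Dnk F 2 4 x ≡ 1# + ι 2 * x
  Dnk-2 x = solve 1 (λ X → con (+ 1) :* 1ᴾ :+ con (-[1+ 1 ]) :* ((:- X) :* 1ᴾ) := 1ᴾ :+ con (+ 2) :* X) refl x

  Dnk-3 : ∀ x → Dnk F 3 4 x ≡ 1# + x
  Dnk-3 x = solve 1 (λ X → con (+ 1) :* 1ᴾ :+ con (-[1+ 0 ]) :* ((:- X) :* 1ᴾ) := 1ᴾ :+ X) refl x

  -- F[√w] = F[T]/(T² - w), with (a , b) standing for a + b√w.
  module QuadraticExtension (w : Carrier) where

    F[√w] : Set
    F[√w] = Carrier Prod.× Carrier

    infixl 6 _⊕_
    infixl 7 _⊗_
    _⊕_ _⊗_ : F[√w] → F[√w] → F[√w]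
    (a , b) ⊕ (c , d) = (a + c , b + d)
    (a , b) ⊗ (c , d) = (a * c + w * (b * d) , a * d + b * c)

    𝟘 𝟙 √w : F[√w]
    𝟘 = (0# , 0#)
    𝟙 = (1# , 0#)
    √w = (0# , 1#)

    ⊕-⊗-isCommutativeSemiring : IsCommutativeSemiring _≡_ _⊕_ _⊗_ 𝟘 𝟙
    ⊕-⊗-isCommutativeSemiring = isCommutativeSemiringˡ record
      { +-isCommutativeMonoid = isCommutativeMonoidˡ record
        { isSemigroup = record { isMagma = record { isEquivalence = isEquivalence ; ∙-cong = cong₂ _⊕_ } ; assoc = ⊕-assoc }
        ; identityˡ = λ { (a , b) → cong₂ _,_ (+-identityˡ a) (+-identityˡ b) }
        ; comm = λ { (a , b) (c , d) → cong₂ _,_ (+-comm a c) (+-comm b d) } }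
      ; *-isCommutativeMonoid = isCommutativeMonoidˡ record
        { isSemigroup = record { isMagma = record { isEquivalence = isEquivalence ; ∙-cong = cong₂ _⊗_ } ; assoc = ⊗-assoc }
        ; identityˡ = λ { (a , b) → cong₂ _,_
            (solve 3 (λ W a b → 1ᴾ :* a :+ W :* (0ᴾ :* b) := a) refl w a b)
            (solve 2 (λ a b → 1ᴾ :* b :+ 0ᴾ :* a := b) refl a b) }
        ; comm = λ { (a , b) (c , d) → cong₂ _,_
            (solve 5 (λ W a b c d → a :* c :+ W :* (b :* d) := c :* a :+ W :* (d :* b)) refl w a b c d)
            (solve 4 (λ a b c d → a :* d :+ b :* c := c :* b :+ d :* a) refl a b c d) } }
      ; distribʳ = λ { (a , b) (c , d) (e , f) → cong₂ _,_
          (solve 7 (λ W a b c d e f → (c :+ e) :* a :+ W :* ((d :+ f) :* b)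
                                      := (c :* a :+ W :* (d :* b)) :+ (e :* a :+ W :* (f :* b))) refl w a b c d e f)
          (solve 6 (λ a b c d e f → (c :+ e) :* b :+ (d :+ f) :* a := (c :* b :+ d :* a) :+ (e :* b :+ f :* a)) refl a b c d e f) }
      ; zeroˡ = λ { (a , b) → cong₂ _,_
          (solve 3 (λ W a b → 0ᴾ :* a :+ W :* (0ᴾ :* b) := 0ᴾ) refl w a b)
          (solve 2 (λ a b → 0ᴾ :* b :+ 0ᴾ :* a := 0ᴾ) refl a b) } }
      where
      ⊕-assoc : ∀ x y z → (x ⊕ y) ⊕ z ≡ x ⊕ (y ⊕ z)
      ⊕-assoc (a , b) (c , d) (e , f) = cong₂ _,_ (+-assoc a c e) (+-assoc b d f)
      ⊗-assoc : ∀ x y z → (x ⊗ y) ⊗ z ≡ x ⊗ (y ⊗ z)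
      ⊗-assoc (a , b) (c , d) (e , f) = cong₂ _,_
        (solve 7 (λ W a b c d e f → (a :* c :+ W :* (b :* d)) :* e :+ W :* ((a :* d :+ b :* c) :* f)
            := a :* (c :* e :+ W :* (d :* f)) :+ W :* (b :* (c :* f :+ d :* e))) refl w a b c d e f)
        (solve 7 (λ W a b c d e f → (a :* c :+ W :* (b :* d)) :* f :+ (a :* d :+ b :* c) :* e
            := a :* (c :* f :+ d :* e) :+ b :* (c :* e :+ W :* (d :* f))) refl w a b c d e f)

    ⊕-⊗-commutativeSemiring : CommutativeSemiring 0ℓ 0ℓ
    ⊕-⊗-commutativeSemiring = record { isCommutativeSemiring = ⊕-⊗-isCommutativeSemiring }

    open SemiringMult (CommutativeSemiring.semiring ⊕-⊗-commutativeSemiring) using () renaming (_×_ to _×ᴱ_)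
    open SemiringExp (CommutativeSemiring.semiring ⊕-⊗-commutativeSemiring) using () renaming (_^_ to _^ᴱ_) public

    n×ᴱ𝟙≡ιn : ∀ n → n ×ᴱ 𝟙 ≡ (ι n , 0#)
    n×ᴱ𝟙≡ιn zero = refl
    n×ᴱ𝟙≡ιn (suc n) = trans (cong (𝟙 ⊕_) (n×ᴱ𝟙≡ιn n)) (cong (ι (suc n) ,_) (+-identityˡ 0#))

    √w^[m+m]≡w^m : ∀ m → √w ^ᴱ (m ℕ.+ m) ≡ (w ^ m , 0#)
    √w^[m+m]≡w^m zero = refl
    √w^[m+m]≡w^m (suc m) = begin
      √w ^ᴱ (suc m ℕ.+ suc m)       ≡⟨ cong (λ k → √w ^ᴱ suc k) (ℕP.+-suc m m) ⟩
      √w ⊗ (√w ⊗ √w ^ᴱ (m ℕ.+ m))   ≡⟨ cong (λ v → √w ⊗ (√w ⊗ v)) (√w^[m+m]≡w^m m) ⟩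
      √w ⊗ (√w ⊗ (w ^ m , 0#))      ≡⟨ cong₂ _,_
        (solve 2 (λ W c → 0ᴾ :* (0ᴾ :* c :+ W :* (1ᴾ :* 0ᴾ)) :+ W :* (1ᴾ :* (0ᴾ :* 0ᴾ :+ 1ᴾ :* c)) := W :* c)
                 refl w (w ^ m))
        (solve 2 (λ W c → 0ᴾ :* (0ᴾ :* 0ᴾ :+ 1ᴾ :* c) :+ 1ᴾ :* (0ᴾ :* c :+ W :* (1ᴾ :* 0ᴾ)) := 0ᴾ) refl w (w ^ m)) ⟩
      (w ^ suc m , 0#) ∎

    √w^[1+m+m]≡w^m√w : ∀ m → √w ^ᴱ suc (m ℕ.+ m) ≡ (0# , w ^ m)
    √w^[1+m+m]≡w^m√w m = trans (cong (√w ⊗_) (√w^[m+m]≡w^m m)) (cong₂ _,_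
      (solve 2 (λ W c → 0ᴾ :* c :+ W :* (1ᴾ :* 0ᴾ) := 0ᴾ) refl w (w ^ m))
      (solve 1 (λ c → 0ᴾ :* 0ᴾ :+ 1ᴾ :* c := c) refl (w ^ m)))

    [√w+𝟙]^[p^l] : ∀ {p} → Prime p → ι p ≡ 0# → ∀ l {q} → p ℕ.^ l ≡ suc (q ℕ.+ q) →
                   (√w ⊕ 𝟙) ^ᴱ (p ℕ.^ l) ≡ (0# + 1# , w ^ q + 0#)
    [√w+𝟙]^[p^l] {p} p-prime char-p l {q} p^l≡1+2q = begin
      (√w ⊕ 𝟙) ^ᴱ Q             ≡⟨ ^-prime^-+ p-prime (trans (n×ᴱ𝟙≡ιn p) (cong (_, 0#) char-p)) l √w 𝟙 ⟩
      √w ^ᴱ Q ⊕ 𝟙 ^ᴱ Q          ≡⟨ cong₂ _⊕_ (cong (√w ^ᴱ_) p^l≡1+2q) (1#^n≈1# Q) ⟩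
      √w ^ᴱ suc (q ℕ.+ q) ⊕ 𝟙   ≡⟨ cong (_⊕ 𝟙) (√w^[1+m+m]≡w^m√w q) ⟩
      (0# + 1# , w ^ q + 0#) ∎
      where
      open Frobenius ⊕-⊗-commutativeSemiring using (^-prime^-+; 1#^n≈1#)
      Q = p ℕ.^ l

  module ClosedForm (x : Carrier) where

    w : Carrier
    w = - ι 4 * x + 1#

    open QuadraticExtension w

    u : F[√w]
    u = √w ⊕ 𝟙

    step : Carrier → Carrier → Carrier
    step s₁ s₀ = ι 2 * s₁ + - (ι 4 * x) * s₀

    ℓ : F[√w] → Carrier
    ℓ (a , b) = (1# + ι 2 * x) * a + b

    scaledD pairing : ℕ → Carrier
    scaledD k = ι 2 ^ k * Dnk F (2 ℕ.+ k) 4 x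
    pairing k = ℓ (u ^ᴱ k)

    scaledD-recurrence : ∀ k → scaledD (2 ℕ.+ k) ≡ step (scaledD (1 ℕ.+ k)) (scaledD k)
    scaledD-recurrence k = begin
      ι 2 * (ι 2 * P) * Dnk F (4 ℕ.+ k) 4 x                     ≡⟨ cong (ι 2 * (ι 2 * P) *_) (Dnk-recurrence k x) ⟩
      ι 2 * (ι 2 * P) * (D₃ + (- x) * D₂)
        ≡⟨ solve 4 (λ P D₃ D₂ X → con (+ 2) :* (con (+ 2) :* P) :* (D₃ :+ (:- X) :* D₂)
                                 := con (+ 2) :* (con (+ 2) :* P :* D₃) :+ (:- (con (+ 4) :* X)) :* (P :* D₂))
                 refl P D₃ D₂ x ⟩
      step (scaledD (1 ℕ.+ k)) (scaledD k) ∎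
      where
      P = ι 2 ^ k
      D₃ = Dnk F (3 ℕ.+ k) 4 x
      D₂ = Dnk F (2 ℕ.+ k) 4 x

    pairing-recurrence : ∀ k → pairing (2 ℕ.+ k) ≡ step (pairing (1 ℕ.+ k)) (pairing k)
    pairing-recurrence k = solve 3 (λ X α β →
        let W = :- con (+ 4) :* X :+ 1ᴾ
            U₁ = 0ᴾ :+ 1ᴾ
            U₂ = 1ᴾ :+ 0ᴾ
            ⟨_,_⟩ = λ a b → (1ᴾ :+ con (+ 2) :* X) :* a :+ b
            γ = U₁ :* α :+ W :* (U₂ :* β)
            δ = U₁ :* β :+ U₂ :* α
        in ⟨ U₁ :* γ :+ W :* (U₂ :* δ) , U₁ :* δ :+ U₂ :* γ ⟩
           := con (+ 2) :* ⟨ γ , δ ⟩ :+ (:- (con (+ 4) :* X)) :* ⟨ α , β ⟩)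
      refl x (proj₁ (u ^ᴱ k)) (proj₂ (u ^ᴱ k))

    scaledD≡pairing : ∀ k → scaledD k ≡ pairing k
    scaledD≡pairing = recurrence₂-unique step scaledD-recurrence pairing-recurrence at-0 at-1
      where
      at-0 : scaledD 0 ≡ pairing 0
      at-0 = trans (cong (1# *_) (Dnk-2 x))
        (solve 1 (λ X → 1ᴾ :* (1ᴾ :+ con (+ 2) :* X) := (1ᴾ :+ con (+ 2) :* X) :* 1ᴾ :+ 0ᴾ) refl x)
      at-1 : scaledD 1 ≡ pairing 1
      at-1 = begin
        ι 2 * 1# * Dnk F 3 4 x                    ≡⟨ cong (ι 2 * 1# *_) (Dnk-3 x) ⟩
        ι 2 * 1# * (1# + x)                       ≡⟨ solve 1 (λ X → con (+ 2) :* 1ᴾ :* (1ᴾ :+ X)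
                                                       := (1ᴾ :+ con (+ 2) :* X) :* (0ᴾ :+ 1ᴾ) :+ (1ᴾ :+ 0ᴾ)) refl x ⟩
        ℓ u                                       ≡⟨ cong ℓ (CommutativeSemiring.*-identityʳ ⊕-⊗-commutativeSemiring u) ⟨
        ℓ (u ⊗ 𝟙) ∎

    2*Dnk[p^l+2]≡1+2x+w^q : ∀ {p} → Prime p → ι p ≡ 0# → ∀ l {q} → p ℕ.^ l ≡ suc (q ℕ.+ q) →
                            ι 2 * Dnk F (p ℕ.^ l ℕ.+ 2) 4 x ≡ 1# + ι 2 * x + w ^ q
    2*Dnk[p^l+2]≡1+2x+w^q {p} p-prime char-p l {q} p^l≡1+2q = begin
      ι 2 * Dnk F (Q ℕ.+ 2) 4 x
        ≡⟨ cong₂ _*_ (ι2^[p^l]≡ι2 p-prime char-p l) (cong (λ n → Dnk F n 4 x) (ℕP.+-comm 2 Q)) ⟨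
      scaledD Q                                    ≡⟨ scaledD≡pairing Q ⟩
      pairing Q                                    ≡⟨ cong ℓ ([√w+𝟙]^[p^l] p-prime char-p l {q} p^l≡1+2q) ⟩
      (1# + ι 2 * x) * (0# + 1#) + (w ^ q + 0#)    ≡⟨ solve 2 (λ X W → (1ᴾ :+ con (+ 2) :* X) :* (0ᴾ :+ 1ᴾ) :+ (W :+ 0ᴾ)
                                                                        := 1ᴾ :+ con (+ 2) :* X :+ W) refl x (w ^ q) ⟩
      1# + ι 2 * x + w ^ q ∎
      where Q = p ℕ.^ l

  module Conjugacy {p} (p-prime : Prime p) (char-p : ι p ≡ 0#) (l : ℕ) {q} (p^l≡1+2q : p ℕ.^ l ≡ suc (q ℕ.+ q))
                   {h} (2h≡1 : ι 2 * h ≡ 1#) where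

    binomial φ ψ : Carrier → Carrier
    binomial y = y ^ q - h * y
    φ z = h * z + h * (1# + h)
    ψ y = - ι 4 * y + 1#

    Dnk≗φ∘binomial∘ψ : ∀ x → Dnk F (p ℕ.^ l ℕ.+ 2) 4 x ≡ φ (binomial (ψ x))
    Dnk≗φ∘binomial∘ψ x = begin
      D                                          ≡⟨ *-identityˡ D ⟨
      1# * D                                     ≡⟨ cong (_* D) (trans (*-comm h (ι 2)) 2h≡1) ⟨
      h * ι 2 * D                                ≡⟨ *-assoc h (ι 2) D ⟩
      h * (ι 2 * D)                              ≡⟨ cong (h *_) (2*Dnk[p^l+2]≡1+2x+w^q p-prime char-p l {q} p^l≡1+2q) ⟩
      h * (1# + ι 2 * x + W)                     ≡⟨ solve 3 (λ H X W → H :* (1ᴾ :+ con (+ 2) :* X :+ W)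
                                                      := H :* (W :- H :* (:- con (+ 4) :* X :+ 1ᴾ)) :+ H :* (1ᴾ :+ H)
                                                         :+ (1ᴾ :- con (+ 2) :* H) :* (con (+ 2) :* H :* X)) refl h x W ⟩
      φ (binomial (ψ x)) + (1# - ι 2 * h) * E    ≡⟨ cong (λ e → φ (binomial (ψ x)) + (1# - e) * E) 2h≡1 ⟩
      φ (binomial (ψ x)) + (1# - 1#) * E         ≡⟨ solve 2 (λ B E → B :+ (1ᴾ :- 1ᴾ) :* E := B) refl _ E ⟩
      φ (binomial (ψ x)) ∎
      where
      open ClosedForm x using (2*Dnk[p^l+2]≡1+2x+w^q)
      D = Dnk F (p ℕ.^ l ℕ.+ 2) 4 x
      W = ψ x ^ q
      E = ι 2 * h * x

    Dnk-permutation⇔binomial-permutation : IsPermutation F (Dnk F (p ℕ.^ l ℕ.+ 2) 4) ⇔ IsPermutation F binomial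
    Dnk-permutation⇔binomial-permutation =
      ⇔.trans (mk⇔ (bijective-resp-≗ Dnk≗φ∘binomial∘ψ) (bijective-resp-≗ (sym ∘ Dnk≗φ∘binomial∘ψ)))
              (⇔.sym (bijective⇔bijective-conjugate φ-bijective ψ-bijective binomial))
      where
      φ-bijective : Bijective _≡_ _≡_ φ
      φ-bijective = affine-bijective (h * (1# + h)) 2h≡1
      [-h²]*[-4]≡1 : - (h * h) * - ι 4 ≡ 1#
      [-h²]*[-4]≡1 = begin
        - (h * h) * - ι 4            ≡⟨ solve 1 (λ H → :- (H :* H) :* :- con (+ 4) := con (+ 2) :* H :* (con (+ 2) :* H)) refl h ⟩
        (ι 2 * h) * (ι 2 * h)        ≡⟨ cong₂ _*_ 2h≡1 2h≡1 ⟩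
        1# * 1#                      ≡⟨ *-identityˡ 1# ⟩
        1# ∎
      ψ-bijective : Bijective _≡_ _≡_ ψ
      ψ-bijective = affine-bijective 1# [-h²]*[-4]≡1

-- Imported only now: inside Dickson, _+_ and _^_ are the operations of F.
open import Data.Nat using (_+_; _^_)

theorem2p16 : (p : ℕ) → Prime p → 3 < p →
    (F : FiniteField) →
    _×1 F p ≡ FiniteField.0# F →
    (∃ λ e → FiniteField.size F ≡ p ^ e) →
    (l : ℕ) →
    IsPermutation F (Dnk F (p ^ l + 2) 4)
      ⇔ IsPermutation F (λ x → FiniteField._+_ F (_^F_ F x ((p ^ l ∸ 1) / 2))
            (FiniteField.-_ F (FiniteField._*_ F (FiniteField._⁻¹ F (FiniteField._+_ F (FiniteField.1# F) (FiniteField.1# F))) x)))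
theorem2p16 p p-prime 3<p F char-p _ l =
  Dickson.Conjugacy.Dnk-permutation⇔binomial-permutation F p-prime char-p l {(p ^ l ∸ 1) / 2}
    (odd⇒≡1+2[[n∸1]/2] (odd⇒odd^ p-odd l)) (Dickson.2*[1+1]⁻¹≡1 F p-odd char-p)
  where
  p-odd : Odd p
  p-odd = prime>2⇒odd p-prime (ℕP.<-trans (ℕP.n<1+n 2) 3<p)
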